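{- Let $S\subseteq (X\times Y)\times Z$ be a communication problem. There exists $\Lambda\subseteq X\times Y$ such that for every subset $\tilde\Lambda\subseteq\Lambda$, $$\mathsf{Cov}(\tilde\Lambda)\geq\frac{|\tilde\Lambda|}{|\Lambda|}\cdot\frac{\mathsf{Cov}(S)}{16\log|X||Y|}.$$ In particular, whenever $\frac{|\tilde\Lambda|}{|\Lambda|}>\frac{16\log|X||Y|}{\mathsf{Cov}(S)}$ we have $\mathsf{Cov}(\tilde\Lambda)>1$, so $\Lambda$ is a $\frac{16\log|X||Y|}{\mathsf{Cov}(S)}$-fooling set of $S$.
   Context: A communication problem is a relation $S\subseteq (X\times Y)\times Z$ with $X,Y,Z$ finite sets; for every $(x,y)\in X\times Y$ there is at least one $z$ with $(x,y,z)\in S$. A rectangle is a set $A'\times B'$ with $A'\subseteq X$, $B'\subseteq Y$; it is monochromatic (with color $z$) if $(x,y,z)\in S$ for all its elements. For $\Sigma\subseteq X\times Y$, $\mathsf{Cov}(\Sigma)$ is the minimum number of monochromatic rectangles whose union contains $\Sigma$, and $\mathsf{Cov}(S)=\mathsf{Cov}(X\times Y)$. A set $\Lambda\subseteq X\times Y$ is a $\delta$-fooling set of $S$ if for every $\tilde\Lambda\subseteq\Lambda$ with $|\tilde\Lambda|/|\Lambda|>\delta$ there is no monochromatic rectangle containing all elements of $\tilde\Lambda$. Logarithms are base 2. -}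

module Defs where

open import Data.Nat using (ℕ; _≤_)
open import Data.Bool using (Bool; T; true)
open import Data.Bool.Properties using (T?)
open import Data.Fin using (Fin)
open import Data.Fin.Subset using (Subset; _∈_)
open import Data.List using (List; length; filter; cartesianProduct; allFin)
open import Data.List.Relation.Unary.All using (All)
open import Data.List.Relation.Unary.Any using (Any)
open import Data.Product using (Σ; ∃; _×_; _,_; proj₁; proj₂)
open import Relation.Binary.PropositionalEquality using (_≡_)

-- X = Fin m, Y = Fin n, Z = Fin k.  A communication problem is a relation
-- S x y z (together with decidability and totality, assumed in the statement).

SubXY : ℕ → ℕ → Set
SubXY m n = Fin m → Fin n → Bool

fullXY : ∀ {m n} → SubXY m n
fullXY _ _ = true

_⊆XY_ : ∀ {m n} → SubXY m n → SubXY m n → Set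
_⊆XY_ {m} {n} P Q = ∀ (x : Fin m) (y : Fin n) → T (P x y) → T (Q x y)

card : ∀ {m n} → SubXY m n → ℕ
card {m} {n} P =
  length (filter (λ (p : Fin m × Fin n) → T? (P (proj₁ p) (proj₂ p)))
                 (cartesianProduct (allFin m) (allFin n)))

Rect : ℕ → ℕ → Set
Rect m n = Subset m × Subset n

Monochromatic : ∀ {m n k} → (Fin m → Fin n → Fin k → Set) → Rect m n → Set
Monochromatic {m} {n} {k} S (A , B) =
  ∃ λ (z : Fin k) → ∀ (x : Fin m) (y : Fin n) → x ∈ A → y ∈ B → S x y z

MonoCover : ∀ {m n k} → (Fin m → Fin n → Fin k → Set) → SubXY m n → List (Rect m n) → Set
MonoCover {m} {n} S Σ' Rs =
  All (Monochromatic S) Rs ×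
  (∀ (x : Fin m) (y : Fin n) → T (Σ' x y) → Any (λ R → x ∈ proj₁ R × y ∈ proj₂ R) Rs)

IsCov : ∀ {m n k} → (Fin m → Fin n → Fin k → Set) → SubXY m n → ℕ → Set
IsCov {m} {n} S Σ' c =
  (∃ λ (Rs : List (Rect m n)) → MonoCover S Σ' Rs × length Rs ≡ c) ×
  (∀ (Rs : List (Rect m n)) → MonoCover S Σ' Rs → c ≤ length Rs)

{-# OPTIONS --safe #-}
module Submission where

-- Call Λ a (b/t)-fooling set if every monochromatic rectangle contains at most a b/t
-- fraction of Λ; if Λ̃ ⊆ Λ is then covered by c monochromatic rectangles, |Λ̃| t ≤ c b |Λ|.
-- Take b = 16 L with 2^L ≤ |X||Y| < 2^(L+1) and run a greedy cover: while the remaining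
-- set is not (b/t)-fooling, remove a monochromatic rectangle holding more than a b/t
-- fraction of it.  The remainder shrinks by the factor (t - b)/t per step, so unless the
-- process stops at a nonempty fooling set it covers X × Y with fewer than t rectangles.
-- For t = Cov(S) that is impossible, and |Λ̃| Cov(S) ≤ 16 L c |Λ| exponentiates to the claim.

open import Defs
open import Data.Nat using (ℕ; zero; suc; _+_; _∸_; _≤_; _<_; _*_; _^_; z≤n; s≤s; NonZero; >-nonZero; _≟_; _<?_; _≤?_; _/_; _%_)
open import Data.Nat.Properties
open import Data.Nat.DivMod using (m≡m%n+[m/n]*n; m%n<n; m/n*n≤m)
open import Data.Nat.Tactic.RingSolver using (solve-∀)
open import Data.Bool using (Bool; true; false; T; _∧_; not)
open import Data.Bool.Properties using (T?; T-∧)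
open import Data.Unit using (tt)
open import Data.Fin using (Fin)
open import Data.Fin.Properties using (any?; all?)
open import Data.Fin.Subset using (_∈_; ⁅_⁆)
open import Data.Fin.Subset.Properties using (_∈?_; anySubset?; x∈⁅x⁆; x∈⁅y⁆⇒x≡y)
open import Data.List using (List; []; _∷_; length; filter; cartesianProduct; allFin; map; _++_)
open import Data.List.Properties using (length-++; length-map; length-tabulate; filter-all; filter-none; filter-some)
open import Data.List.Relation.Unary.All as All using (All; []; _∷_)
open import Data.List.Relation.Unary.Any using (Any; here; there)
open import Data.List.Relation.Unary.All.Properties using () renaming (map⁺ to All-map⁺)
open import Data.List.Relation.Unary.Any.Properties using () renaming (map⁺ to Any-map⁺)
open import Data.List.Membership.Propositional using (lose) renaming (_∈_ to _∈ₗ_)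
open import Data.List.Membership.Propositional.Properties using (∈-cartesianProduct⁺; ∈-allFin)
open import Data.List.Relation.Binary.Sublist.Propositional using (⊆-refl)
open import Data.List.Relation.Binary.Sublist.Propositional.Properties using (filter⁺; length-mono-≤)
open import Data.Product using (∃; _×_; _,_; proj₁; proj₂)
open import Data.Sum as Sum using (_⊎_; inj₁; inj₂)
open import Data.Empty using (⊥-elim)
open import Function using (case_of_)
open import Function.Bundles using (Equivalence)
open import Relation.Nullary using (Dec; yes; no; ¬_)
open import Relation.Nullary.Decidable using (⌊_⌋; _×-dec_; _→-dec_; map′; toWitness; fromWitness)
open import Relation.Binary.PropositionalEquality using (_≡_; refl; sym; trans; cong; cong₂; subst; subst₂; module ≡-Reasoning)

length-filter-split : ∀ {A : Set} (f g : A → Bool) xs →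
  length (filter (λ x → T? (f x)) xs) ≡
  length (filter (λ x → T? (f x ∧ g x)) xs) + length (filter (λ x → T? (f x ∧ not (g x))) xs)
length-filter-split f g [] = refl
length-filter-split f g (x ∷ xs) with f x | g x
... | true  | true  = cong suc (length-filter-split f g xs)
... | true  | false = trans (cong suc (length-filter-split f g xs)) (sym (+-suc _ _))
... | false | _     = length-filter-split f g xs

length-cartesianProduct : ∀ {A B : Set} (xs : List A) (ys : List B) →
  length (cartesianProduct xs ys) ≡ length xs * length ys
length-cartesianProduct [] ys = refl
length-cartesianProduct (x ∷ xs) ys = begin
  length (map (x ,_) ys ++ cartesianProduct xs ys)          ≡⟨ length-++ (map (x ,_) ys) ⟩
  length (map (x ,_) ys) + length (cartesianProduct xs ys)  ≡⟨ cong₂ _+_ (length-map (x ,_) ys) (length-cartesianProduct xs ys) ⟩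
  length ys + length xs * length ys                         ∎
  where open ≡-Reasoning

2^L≤n<2^[1+L] : ∀ n → 0 < n → ∃ λ L → 2 ^ L ≤ n × n < 2 ^ suc L
2^L≤n<2^[1+L] zero ()
2^L≤n<2^[1+L] (suc zero) _ = 0 , ≤-refl , s≤s (s≤s z≤n)
2^L≤n<2^[1+L] (suc (suc n)) _ with 2^L≤n<2^[1+L] (suc n) (s≤s z≤n)
... | L , lo , hi with suc (suc n) <? 2 ^ suc L
...   | yes n+1<2^[1+L] = L , m≤n⇒m≤1+n lo , n+1<2^[1+L]
...   | no  n+1≮2^[1+L] = suc L , ≤-reflexive (sym n+1≡2^[1+L]) , n+1<2^[2+L]
  where
  n+1≡2^[1+L] : suc (suc n) ≡ 2 ^ suc L
  n+1≡2^[1+L] = ≤-antisym hi (≮⇒≥ n+1≮2^[1+L])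
  n+1<2^[2+L] : suc (suc n) < 2 ^ suc (suc L)
  n+1<2^[2+L] = subst (_< 2 ^ suc (suc L)) (sym n+1≡2^[1+L])
    (m<m+n (2 ^ suc L) (subst (0 <_) (sym (+-identityʳ _)) (m^n>0 2 (suc L))))

^-distribʳ-* : ∀ x y e → (x * y) ^ e ≡ x ^ e * y ^ e
^-distribʳ-* x y zero = refl
^-distribʳ-* x y (suc e) = trans (cong ((x * y) *_) (^-distribʳ-* x y e)) (interchange x y (x ^ e) (y ^ e))
  where
  interchange : ∀ x y X Y → x * y * (X * Y) ≡ x * X * (y * Y)
  interchange = solve-∀

-- Bernoulli's inequality (1 + b/a)^q ≥ 1 + q b/a, multiplied by a^(q+1).
bernoulli : ∀ a b q → a ^ q * (a + q * b) ≤ a * (a + b) ^ q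
bernoulli a b zero = ≤-reflexive (trans (+-identityʳ (a + 0)) (trans (+-identityʳ a) (sym (*-identityʳ a))))
bernoulli a b (suc q) = begin
  a * X * (a + suc q * b)                       ≡⟨ expand a b q X ⟩
  a * (X * (a + q * b)) + b * (X * a)           ≤⟨ +-monoʳ-≤ (a * (X * (a + q * b))) (*-monoʳ-≤ b (*-monoʳ-≤ X (m≤m+n a (q * b)))) ⟩
  a * (X * (a + q * b)) + b * (X * (a + q * b)) ≡⟨ sym (*-distribʳ-+ (X * (a + q * b)) a b) ⟩
  (a + b) * (X * (a + q * b))                   ≤⟨ *-monoʳ-≤ (a + b) (bernoulli a b q) ⟩
  (a + b) * (a * Y)                             ≡⟨ *-comm-middle a b Y ⟩
  a * ((a + b) * Y)                             ∎
  where
  open ≤-Reasoning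
  X = a ^ q
  Y = (a + b) ^ q
  expand : ∀ a b q X → a * X * (a + suc q * b) ≡ a * (X * (a + q * b)) + b * (X * a)
  expand = solve-∀
  *-comm-middle : ∀ a b Y → (a + b) * (a * Y) ≡ a * ((a + b) * Y)
  *-comm-middle = solve-∀

2*a^q≤[a+b]^q : ∀ a b q .{{_ : NonZero a}} → a ≤ q * b → 2 * a ^ q ≤ (a + b) ^ q
2*a^q≤[a+b]^q a b q a≤qb = *-cancelˡ-≤ a (begin
  a * (2 * a ^ q)      ≡⟨ rearrange a (a ^ q) ⟩
  a ^ q * (a + a)      ≤⟨ *-monoʳ-≤ (a ^ q) (+-monoʳ-≤ a a≤qb) ⟩
  a ^ q * (a + q * b)  ≤⟨ bernoulli a b q ⟩
  a * (a + b) ^ q      ∎)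
  where
  open ≤-Reasoning
  rearrange : ∀ a X → a * (2 * X) ≡ X * (a + a)
  rearrange = solve-∀

DecayWithin : ℕ → ℕ → ℕ → Set
DecayWithin N b t = ∃ λ J → J < t × N * (t ∸ b) ^ J < t ^ J

-- With q = ⌊t/b⌋ + 1 the factor ((t - b)/t)^q is at most 1/2, so J = q (L + 1) steps
-- push N < 2^(L+1) below 1; and 8 J ≤ b q ≤ b + t < 2 t because L ≥ 1.
decayWithin : ∀ {N l t} → N < 2 ^ suc (suc l) → 16 * suc l < t → DecayWithin N (16 * suc l) t
decayWithin {N} {l} {t} N<2^[1+L] b<t = J , J<t , decayed
  where
  L = suc l
  b = 16 * L
  a = t ∸ b
  q = suc (t / b)
  J = q * suc L
  instance
    a≢0 : NonZero a
    a≢0 = >-nonZero (m<n⇒0<n∸m b<t)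
  t≤qb : t ≤ q * b
  t≤qb = begin
    t                 ≡⟨ m≡m%n+[m/n]*n t b ⟩
    t % b + t / b * b ≤⟨ +-monoˡ-≤ (t / b * b) (<⇒≤ (m%n<n t b)) ⟩
    b + t / b * b     ∎
    where open ≤-Reasoning
  2a^q≤t^q : 2 * a ^ q ≤ t ^ q
  2a^q≤t^q = subst (λ u → 2 * a ^ q ≤ u ^ q) (m∸n+n≡m (<⇒≤ b<t)) (2*a^q≤[a+b]^q a b q (≤-trans (m∸n≤m t b) t≤qb))
  decayed : N * a ^ J < t ^ J
  decayed = begin-strict
    N * a ^ J                   <⟨ *-monoˡ-< (a ^ J) {{>-nonZero (m^n>0 a J)}} N<2^[1+L] ⟩
    2 ^ suc L * a ^ J           ≡⟨ cong (2 ^ suc L *_) (sym (^-*-assoc a q (suc L))) ⟩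
    2 ^ suc L * (a ^ q) ^ suc L ≡⟨ sym (^-distribʳ-* 2 (a ^ q) (suc L)) ⟩
    (2 * a ^ q) ^ suc L         ≤⟨ ^-monoˡ-≤ (suc L) 2a^q≤t^q ⟩
    (t ^ q) ^ suc L             ≡⟨ ^-*-assoc t q (suc L) ⟩
    t ^ J                       ∎
    where open ≤-Reasoning
  J<t : J < t
  J<t = *-cancelˡ-< 8 J t (begin-strict
    8 * (q * suc L)               ≤⟨ m≤m+n (8 * (q * suc L)) (8 * (q * l)) ⟩
    8 * (q * suc L) + 8 * (q * l) ≡⟨ rearrange (t / b) l ⟩
    b + t / b * b                 ≤⟨ +-monoʳ-≤ b (m/n*n≤m t b) ⟩
    b + t                         <⟨ +-monoˡ-< t b<t ⟩
    t + t                         ≤⟨ +-monoʳ-≤ t (m≤m+n t _) ⟩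
    8 * t                         ∎)
    where
    open ≤-Reasoning
    rearrange : ∀ d l → 8 * (suc d * suc (suc l)) + 8 * (suc d * l) ≡ 16 * suc l + d * (16 * suc l)
    rearrange = solve-∀

remainder-shrinks : ∀ {s r s′ b t} → s ≡ r + s′ → b * s < r * t → b ≤ t → t * s′ < s * (t ∸ b)
remainder-shrinks {s} {r} {s′} {b} {t} s≡r+s′ bs<rt b≤t =
  +-cancelʳ-< (r * t) (t * s′) (s * a) (begin-strict
    t * s′ + r * t ≡⟨ split ⟩
    s * a + b * s  <⟨ +-monoʳ-< (s * a) bs<rt ⟩
    s * a + r * t  ∎)
  where
  open ≤-Reasoning
  a = t ∸ b
  split : t * s′ + r * t ≡ s * a + b * s
  split = begin-equality
    t * s′ + r * t ≡⟨ collect t s′ r ⟩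
    (r + s′) * t   ≡⟨ cong (_* t) (sym s≡r+s′) ⟩
    s * t          ≡⟨ cong (s *_) (sym (m∸n+n≡m b≤t)) ⟩
    s * (a + b)    ≡⟨ distribute s a b ⟩
    s * a + b * s  ∎
    where
    collect : ∀ t s′ r → t * s′ + r * t ≡ (r + s′) * t
    collect = solve-∀
    distribute : ∀ s a b → s * (a + b) ≡ s * a + b * s
    distribute = solve-∀

2^-log₂-bound : ∀ {N L e c s} → 2 ^ L ≤ N → e ≤ c * (16 * L * s) → 2 ^ e ≤ N ^ (16 * c * s)
2^-log₂-bound {N} {L} {e} {c} {s} 2^L≤N e≤ = begin
  2 ^ e                  ≤⟨ ^-monoʳ-≤ 2 (≤-trans e≤ (≤-reflexive (rearrange c L s))) ⟩
  2 ^ (L * (16 * c * s)) ≡⟨ sym (^-*-assoc 2 L (16 * c * s)) ⟩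
  (2 ^ L) ^ (16 * c * s) ≤⟨ ^-monoˡ-≤ (16 * c * s) 2^L≤N ⟩
  N ^ (16 * c * s)       ∎
  where
  open ≤-Reasoning
  rearrange : ∀ c L s → c * (16 * L * s) ≡ L * (16 * c * s)
  rearrange = solve-∀

module _ {m n : ℕ} where

  points : List (Fin m × Fin n)
  points = cartesianProduct (allFin m) (allFin n)

  ∈-points : ∀ x y → (x , y) ∈ₗ points
  ∈-points x y = ∈-cartesianProduct⁺ (∈-allFin x) (∈-allFin y)

  infixl 7 _∩_ _∖_

  _∩_ : SubXY m n → SubXY m n → SubXY m n
  (P ∩ Q) x y = P x y ∧ Q x y

  _∖_ : SubXY m n → SubXY m n → SubXY m n
  (P ∖ Q) x y = P x y ∧ not (Q x y)

  ⟦_⟧ : Rect m n → SubXY m n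
  ⟦ A , B ⟧ x y = ⌊ x ∈? A ⌋ ∧ ⌊ y ∈? B ⌋

  ⟦⟧⁺ : ∀ {x y} R → x ∈ proj₁ R × y ∈ proj₂ R → T (⟦ R ⟧ x y)
  ⟦⟧⁺ {x} {y} (A , B) (x∈A , y∈B) = Equivalence.from (T-∧ {⌊ x ∈? A ⌋}) (fromWitness x∈A , fromWitness y∈B)

  ⟦⟧⁻ : ∀ {x y} R → T (⟦ R ⟧ x y) → x ∈ proj₁ R × y ∈ proj₂ R
  ⟦⟧⁻ {x} {y} (A , B) p = let a , b = Equivalence.to (T-∧ {⌊ x ∈? A ⌋}) p in toWitness a , toWitness b

  card-mono : ∀ {P Q : SubXY m n} → P ⊆XY Q → card P ≤ card Q
  card-mono {P} {Q} P⊆Q = length-mono-≤ (filter⁺ (λ p → T? (P (proj₁ p) (proj₂ p))) (λ p → T? (Q (proj₁ p) (proj₂ p)))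
    (λ { refl → P⊆Q _ _ }) (⊆-refl {x = points}))

  card-∩-∖ : ∀ (P Q : SubXY m n) → card P ≡ card (P ∩ Q) + card (P ∖ Q)
  card-∩-∖ P Q = length-filter-split (λ p → P (proj₁ p) (proj₂ p)) (λ p → Q (proj₁ p) (proj₂ p)) points

  card-pos : ∀ {P : SubXY m n} {x y} → T (P x y) → 0 < card P
  card-pos {P} {x} {y} p = filter-some (λ q → T? (P (proj₁ q) (proj₂ q))) (lose (∈-points x y) p)

  card-empty : ∀ {P : SubXY m n} → (∀ x y → ¬ T (P x y)) → card P ≡ 0
  card-empty {P} P≡∅ = cong length (filter-none (λ q → T? (P (proj₁ q) (proj₂ q)))
    (All.universal (λ q → P≡∅ (proj₁ q) (proj₂ q)) points))

  length-points : length points ≡ m * n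
  length-points = begin
    length points                         ≡⟨ length-cartesianProduct (allFin m) (allFin n) ⟩
    length (allFin m) * length (allFin n) ≡⟨ cong₂ _*_ (length-tabulate {n = m} (λ x → x)) (length-tabulate {n = n} (λ y → y)) ⟩
    m * n                                 ∎
    where open ≡-Reasoning

  card-full : card (fullXY {m} {n}) ≡ m * n
  card-full = trans (cong length (filter-all (λ _ → T? true) (All.universal (λ _ → tt) points))) length-points

  ∖⁻ : ∀ {P Q : SubXY m n} {x y} → T ((P ∖ Q) x y) → T (P x y) × ¬ T (Q x y)
  ∖⁻ {P} {Q} {x} {y} p with P x y | Q x y
  ... | true  | false = tt , λ ()
  ... | true  | true  = ⊥-elim p
  ... | false | _     = ⊥-elim p

  ∖⁺ : ∀ {P Q : SubXY m n} {x y} → T (P x y) → ¬ T (Q x y) → T ((P ∖ Q) x y)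
  ∖⁺ {P} {Q} {x} {y} p q with P x y | Q x y
  ... | true  | true  = q tt
  ... | true  | false = tt

  ∩-monoˡ : ∀ {P Q : SubXY m n} R → P ⊆XY Q → (P ∩ R) ⊆XY (Q ∩ R)
  ∩-monoˡ {P} {Q} R P⊆Q x y p = let Px , Rx = Equivalence.to (T-∧ {P x y}) p in
    Equivalence.from (T-∧ {Q x y}) (P⊆Q x y Px , Rx)

  infix 4 _⊆⋃_

  _⊆⋃_ : SubXY m n → List (Rect m n) → Set
  P ⊆⋃ Rs = ∀ x y → T (P x y) → Any (λ R → x ∈ proj₁ R × y ∈ proj₂ R) Rs

  ⊆⋃-∷⁻ : ∀ {P R Rs} → P ⊆⋃ (R ∷ Rs) → P ∖ ⟦ R ⟧ ⊆⋃ Rs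
  ⊆⋃-∷⁻ {P} {R} P⊆⋃ x y p with ∖⁻ {P} {⟦ R ⟧} p
  ... | Px , ¬Rx with P⊆⋃ x y Px
  ...   | here  x,y∈R = ⊥-elim (¬Rx (⟦⟧⁺ R x,y∈R))
  ...   | there x,y∈Rs = x,y∈Rs

  ⊆⋃-∷⁺ : ∀ {P R Rs} → P ∖ ⟦ R ⟧ ⊆⋃ Rs → P ⊆⋃ (R ∷ Rs)
  ⊆⋃-∷⁺ {P} {R} P∖R⊆⋃ x y p with T? (⟦ R ⟧ x y)
  ... | yes Rx = here (⟦⟧⁻ R Rx)
  ... | no ¬Rx = there (P∖R⊆⋃ x y (∖⁺ {P} {⟦ R ⟧} p ¬Rx))

module _ {m n k : ℕ} (S : Fin m → Fin n → Fin k → Set) where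

  Fooling : ℕ → ℕ → SubXY m n → Set
  Fooling b t Λ = ∀ R → Monochromatic S R → card (Λ ∩ ⟦ R ⟧) * t ≤ b * card Λ

  NonemptyFooling : ℕ → ℕ → Set
  NonemptyFooling b t = ∃ λ Λ → 0 < card Λ × Fooling b t Λ

  CoverWithin : SubXY m n → ℕ → Set
  CoverWithin P u = ∃ λ Rs → MonoCover S P Rs × length Rs ≤ u

  empty-cover : ∀ {P u} → card P ≡ 0 → CoverWithin P u
  empty-cover {P} |P|≡0 = [] , ([] , λ x y p → ⊥-elim (<⇒≢ (card-pos {P = P} p) (sym |P|≡0))) , z≤n

  fooling-cover-bound : ∀ {b t Λ} → Fooling b t Λ → ∀ {P} Rs → P ⊆XY Λ → MonoCover S P Rs →
    card P * t ≤ length Rs * (b * card Λ)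
  fooling-cover-bound {t = t} _ {P} [] _ (_ , P⊆∅) =
    ≤-reflexive (cong (_* t) (card-empty {P = P} λ x y p → case P⊆∅ x y p of λ ()))
  fooling-cover-bound {b} {t} {Λ} fool {P} (R ∷ Rs) P⊆Λ (mono ∷ monos , P⊆⋃) = begin
    card P * t                                ≡⟨ cong (_* t) (card-∩-∖ P ⟦ R ⟧) ⟩
    (card (P ∩ ⟦ R ⟧) + card (P ∖ ⟦ R ⟧)) * t ≡⟨ *-distribʳ-+ t (card (P ∩ ⟦ R ⟧)) _ ⟩
    card (P ∩ ⟦ R ⟧) * t + card (P ∖ ⟦ R ⟧) * t ≤⟨ +-mono-≤ inside outside ⟩
    b * card Λ + length Rs * (b * card Λ)     ∎
    where
    open ≤-Reasoning
    inside : card (P ∩ ⟦ R ⟧) * t ≤ b * card Λ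
    inside = ≤-trans (*-monoˡ-≤ t (card-mono (∩-monoˡ ⟦ R ⟧ P⊆Λ))) (fool R mono)
    outside : card (P ∖ ⟦ R ⟧) * t ≤ length Rs * (b * card Λ)
    outside = fooling-cover-bound {b} {t} {Λ} fool Rs (λ x y p → P⊆Λ x y (proj₁ (∖⁻ {P = P} {Q = ⟦ R ⟧} p)))
      (monos , ⊆⋃-∷⁻ {P = P} P⊆⋃)

  fooling-set-bound : ∀ {L t Λ} → 2 ^ L ≤ m * n → Fooling (16 * L) t Λ → CoverWithin fullXY t →
    ∀ Λ̃ → Λ̃ ⊆XY Λ → ∀ c cS → IsCov S Λ̃ c → IsCov S fullXY cS → 2 ^ (card Λ̃ * cS) ≤ (m * n) ^ (16 * c * card Λ)
  fooling-set-bound {L} {t} {Λ} 2^L≤N fooling (Rs₀ , cover₀ , |Rs₀|≤t) Λ̃ Λ̃⊆Λ _ cS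
                    ((Rs , cover , refl) , _) (_ , minimal) =
    2^-log₂-bound {L = L} {c = length Rs} {s = card Λ} 2^L≤N (begin
      card Λ̃ * cS                   ≤⟨ *-monoʳ-≤ (card Λ̃) (≤-trans (minimal Rs₀ cover₀) |Rs₀|≤t) ⟩
      card Λ̃ * t                    ≤⟨ fooling-cover-bound {16 * L} {t} {Λ} fooling Rs Λ̃⊆Λ cover ⟩
      length Rs * (16 * L * card Λ) ∎)
    where open ≤-Reasoning

  singleton : Fin m × Fin n → Rect m n
  singleton (x , y) = ⁅ x ⁆ , ⁅ y ⁆

  singleton-monochromatic : (∀ x y → ∃ λ z → S x y z) → ∀ p → Monochromatic S (singleton p)
  singleton-monochromatic total (x , y) = let z , Sxyz = total x y in
    z , λ x′ y′ x′∈⁅x⁆ y′∈⁅y⁆ →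
      subst₂ (λ u v → S u v z) (sym (x∈⁅y⁆⇒x≡y x x′∈⁅x⁆)) (sym (x∈⁅y⁆⇒x≡y y y′∈⁅y⁆)) Sxyz

  singleton-cover : (∀ x y → ∃ λ z → S x y z) → CoverWithin fullXY (m * n)
  singleton-cover total = map singleton points ,
    (All-map⁺ (All.universal (singleton-monochromatic total) points) ,
     λ x y _ → Any-map⁺ (lose (∈-points x y) (x∈⁅x⁆ x , x∈⁅x⁆ y))) ,
    ≤-reflexive (trans (length-map singleton points) (length-points {m} {n}))

  module _ (S? : ∀ x y z → Dec (S x y z)) where

    monochromatic? : ∀ R → Dec (Monochromatic S R)
    monochromatic? (A , B) = any? λ z → all? λ x → all? λ y → (x ∈? A) →-dec ((y ∈? B) →-dec S? x y z)

    heavy? : ∀ b t Λ → Dec (∃ λ R → Monochromatic S R × b * card Λ < card (Λ ∩ ⟦ R ⟧) * t)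
    heavy? b t Λ = map′ (λ ((A , B , h)) → (A , B) , h) (λ (((A , B) , h)) → A , B , h)
      (anySubset? λ A → anySubset? λ B → monochromatic? (A , B) ×-dec (b * card Λ <? card (Λ ∩ ⟦ A , B ⟧) * t))

    fooling-or-cover : ∀ {b t} → b ≤ t → ∀ j Λ → card Λ * (t ∸ b) ^ j < t ^ j → NonemptyFooling b t ⊎ CoverWithin Λ j
    fooling-or-cover b≤t zero Λ small = inj₂ (empty-cover (n<1⇒n≡0 (subst (_< 1) (*-identityʳ (card Λ)) small)))
    fooling-or-cover {b} {t} b≤t (suc j) Λ small with card Λ ≟ 0 | heavy? b t Λ
    ... | yes |Λ|≡0 | _        = inj₂ (empty-cover |Λ|≡0)
    ... | no |Λ|≢0  | no ¬heavy = inj₁ (Λ , n≢0⇒n>0 |Λ|≢0 , λ R mono → ≮⇒≥ λ heavy → ¬heavy (R , mono , heavy))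
    ... | no _      | yes (R , mono , heavy) = Sum.map₂ extend (fooling-or-cover b≤t j (Λ ∖ ⟦ R ⟧) smaller)
      where
      a = t ∸ b
      extend : CoverWithin (Λ ∖ ⟦ R ⟧) j → CoverWithin Λ (suc j)
      extend (Rs , (monos , cover) , |Rs|≤j) = R ∷ Rs , (mono ∷ monos , ⊆⋃-∷⁺ {P = Λ} cover) , s≤s |Rs|≤j
      smaller : card (Λ ∖ ⟦ R ⟧) * a ^ j < t ^ j
      smaller = *-cancelˡ-< t _ _ (begin-strict
        t * (card (Λ ∖ ⟦ R ⟧) * a ^ j) ≡⟨ sym (*-assoc t _ _) ⟩
        t * card (Λ ∖ ⟦ R ⟧) * a ^ j   ≤⟨ *-monoˡ-≤ (a ^ j) (<⇒≤ (remainder-shrinks (card-∩-∖ Λ ⟦ R ⟧) heavy b≤t)) ⟩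
        card Λ * a * a ^ j             ≡⟨ *-assoc (card Λ) a (a ^ j) ⟩
        card Λ * a ^ suc j             <⟨ small ⟩
        t ^ suc j                      ∎)
        where open ≤-Reasoning

    fooling-or-smaller-cover : ∀ {b t} → 0 < m * n → (b < t → DecayWithin (m * n) b t) →
      NonemptyFooling b t ⊎ (∃ λ Rs → MonoCover S fullXY Rs × length Rs < t)
    fooling-or-smaller-cover {b} {t} N>0 decay with t ≤? b
    ... | yes t≤b = inj₁ (fullXY , subst (0 <_) (sym (card-full {m} {n})) N>0 , full-fooling)
      where
      full-fooling : Fooling b t fullXY
      full-fooling R _ = ≤-trans (*-mono-≤ (card-mono {P = fullXY ∩ ⟦ R ⟧} {Q = fullXY} (λ _ _ _ → tt)) t≤b)
        (≤-reflexive (*-comm (card (fullXY {m} {n})) b))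
    ... | no t≰b with decay (≰⇒> t≰b)
    ...   | J , J<t , small
      with fooling-or-cover (<⇒≤ (≰⇒> t≰b)) J fullXY (subst (λ N → N * (t ∸ b) ^ J < t ^ J) (sym (card-full {m} {n})) small)
    ...     | inj₁ fooling                 = inj₁ fooling
    ...     | inj₂ (Rs , cover , |Rs|≤J) = inj₂ (Rs , cover , ≤-<-trans |Rs|≤J J<t)

    -- Descending over cover sizes avoids computing Cov(S): the descent stops at a
    -- threshold t for which a cover of size t exists, so that t ≥ Cov(S).
    fooling-above-cover : ∀ {b} → 0 < m * n → (∀ {t} → b < t → DecayWithin (m * n) b t) →
      ∀ u → CoverWithin fullXY u → ∃ λ t → NonemptyFooling b t × CoverWithin fullXY t
    fooling-above-cover N>0 decay u cover with fooling-or-smaller-cover {t = u} N>0 decay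
    ... | inj₁ fooling = u , fooling , cover
    fooling-above-cover N>0 decay zero    _ | inj₂ (_ , _ , ())
    fooling-above-cover N>0 decay (suc u) _ | inj₂ (Rs , cover , s≤s |Rs|≤u) =
      fooling-above-cover N>0 decay u (Rs , cover , |Rs|≤u)

proposition3p7 : ∀ {m n k : ℕ} (S : Fin m → Fin n → Fin k → Set)
    → (∀ x y z → Dec (S x y z))
    → (∀ x y → ∃ λ z → S x y z)
    → 2 ≤ m * n
    → ∃ λ (Λ : SubXY m n) → 0 < card Λ ×
        (∀ (Λ̃ : SubXY m n) → Λ̃ ⊆XY Λ → ∀ (c cS : ℕ)
          → IsCov S Λ̃ c → IsCov S fullXY cS
          → 2 ^ (card Λ̃ * cS) ≤ (m * n) ^ (16 * c * card Λ))
proposition3p7 {m} {n} S S? total 2≤N with 2^L≤n<2^[1+L] (m * n) (≤-trans (s≤s z≤n) 2≤N)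
... | zero , _ , N<2 = ⊥-elim (<⇒≱ N<2 2≤N)
... | suc l , 2^L≤N , N<2^[1+L] =
  let t , (Λ , |Λ|>0 , fooling) , cover =
        fooling-above-cover S S? {16 * suc l} (≤-trans (m^n>0 2 (suc l)) 2^L≤N) (decayWithin N<2^[1+L])
          (m * n) (singleton-cover S total)
  in Λ , |Λ|>0 , fooling-set-bound S {suc l} {t} {Λ} 2^L≤N fooling cover
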